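{- For every typing environment $\Gamma$ and type $\sigma$ of system $\mathcal H$, the set of approximate normal forms $a$ for which there exists a derivation $\Pi\triangleright\Gamma\vdash_{\mathcal H} a:\sigma$ with $a=\mathcal A(\Pi)$ is finite.
   Context: Types: $\sigma,\tau,\rho::=\alpha\mid A\to\tau$, $\alpha$ base types, multiset types $A=[\sigma_i]_{i\in I}$ finite possibly empty multisets of types. Environments $\Gamma$ map variables to multiset types, all but finitely many to $[\,]$; $(\Gamma+\Delta)(x)=\Gamma(x)\uplus\Delta(x)$; $\Gamma\setminus x$ sets $x$ to $[\,]$. System $\mathcal H$: (var) $x{:}[\rho]\vdash x:\rho$; ($\to$I) from $\Gamma\vdash t:\tau$ infer $\Gamma\setminus x\vdash\lambda x.t:\Gamma(x)\to\tau$; (m) from $(\Delta_i\vdash t:\sigma_i)_{i\in I}$ ($I$ finite, possibly empty) infer $+_{i\in I}\Delta_i\vdash t:[\sigma_i]_{i\in I}$; ($\to$E) from $\Gamma\vdash t:A\to\tau$ and $\Delta\vdash u:A$ infer $\Gamma+\Delta\vdash tu:\tau$; these type approximate normal forms, $\Omega$ typable only by (m) with $I=\emptyset$. Approximate normal forms: $a::=\Omega\mid N$, $N::=\lambda x.N\mid L$, $L::=x\mid L\,a$, considered up to renaming of bound variables; $\bigvee$ is least upper bound for the smallest order $\le$ compatible with the constructors with $\Omega\le a$. Approximant of a derivation $\Pi$ with an approximate normal form as subject: $\mathcal A(\Pi)=x$ for (var); $\lambda x.\mathcal A(\Pi')$ for ($\to$I) with premise $\Pi'$; $\mathcal A(\Pi')\mathcal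 A(\Pi'')$ for ($\to$E) with premises $\Pi'$, $\Pi''$; $\bigvee_{i\in I}\mathcal A(\Pi_i)$ for (m) with premises $\Pi_i$ ($\Omega$ if $I=\emptyset$); i.e. the subject with every maximal subterm untyped in $\Pi$ replaced by $\Omega$. -}

module Defs where

open import Data.Nat using (ℕ; zero; suc)
open import Data.List using (List; []; _∷_; _++_)
open import Data.List.Membership.Propositional using (_∈_)
open import Data.Product using (∃-syntax; Σ-syntax; _×_)
open import Relation.Binary.PropositionalEquality using (_≡_)

-- A multiset type
-- [σ_i]_{i∈I} is represented by a list of types, and identified up to
-- the multiset equivalence _≈M_ (permutation, recursively up to _≈T_).

data Ty : Set where
  base : ℕ → Ty
  _⇒_  : List Ty → Ty → Ty

MTy : Set
MTy = List Ty

mutual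
  data _≈T_ : Ty → Ty → Set where
    base : ∀ {n} → base n ≈T base n
    arr  : ∀ {A B σ τ} → A ≈M B → σ ≈T τ → (A ⇒ σ) ≈T (B ⇒ τ)

  data _≈M_ : MTy → MTy → Set where
    []  : [] ≈M []
    _∷_ : ∀ {σ τ A B₁ B₂} → σ ≈T τ → A ≈M (B₁ ++ B₂) →
          (σ ∷ A) ≈M (B₁ ++ τ ∷ B₂)

-- Terms (de Bruijn indices, so terms are taken up to α-renaming),
-- extended with the constant Ω.

data Term : Set where
  Ω   : Term
  var : ℕ → Term
  lam : Term → Term
  app : Term → Term → Term

mutual
  data IsANF : Term → Set where
    Ω  : IsANF Ω
    nf : ∀ {t} → IsNF t → IsANF t

  data IsNF : Term → Set where
    lam : ∀ {t} → IsNF t → IsNF (lam t)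
    ne  : ∀ {t} → IsNe t → IsNF t

  data IsNe : Term → Set where
    var : ∀ {x} → IsNe (var x)
    app : ∀ {l a} → IsNe l → IsANF a → IsNe (app l a)

-- Binary join (least upper bound for the order generated by Ω ≤ a and
-- compatibility with the constructors).  It is only ever applied to
-- compatible arguments (approximants of the same term); on incompatible
-- arguments it returns the left one (arbitrary, never used).
_⊔_ : Term → Term → Term
Ω ⊔ b = b
a ⊔ Ω = a
var x ⊔ var y = var x
lam a ⊔ lam b = lam (a ⊔ b)
app a b ⊔ app c d = app (a ⊔ c) (b ⊔ d)
a ⊔ _ = a

-- Environments: de Bruijn index i ↦ multiset type; indices beyond the
-- end of the list are mapped to [ ] (finite support).

Env : Set
Env = List MTy

_!_ : Env → ℕ → MTy
[] ! _ = []
(A ∷ Γ) ! zero = A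
(A ∷ Γ) ! suc i = Γ ! i

-- Γ(x) for the bound variable (index 0) and Γ \ x (with indices shifted)
hd : Env → MTy
hd [] = []
hd (A ∷ _) = A

tl : Env → Env
tl [] = []
tl (_ ∷ Γ) = Γ

single : ℕ → MTy → Env
single zero A = A ∷ []
single (suc x) A = [] ∷ single x A

∅ : Env
∅ = []

_+E_ : Env → Env → Env
[] +E Δ = Δ
(A ∷ Γ) +E [] = A ∷ Γ
(A ∷ Γ) +E (B ∷ Δ) = (A ++ B) ∷ (Γ +E Δ)

_≈E_ : Env → Env → Set
Γ ≈E Δ = ∀ i → (Γ ! i) ≈M (Δ ! i)

-- System H.  Rule (m) over a finite family (Δ_i ⊢ t : σ_i)_{i∈I} is
-- represented with I enumerated as a list.

mutual
  data _⊢_∶_ : Env → Term → Ty → Set where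
    var : ∀ x ρ → single x (ρ ∷ []) ⊢ var x ∶ ρ
    lam : ∀ {Γ t τ} → Γ ⊢ t ∶ τ → tl Γ ⊢ lam t ∶ (hd Γ ⇒ τ)
    app : ∀ {Γ Δ t u A B τ} → Γ ⊢ t ∶ (A ⇒ τ) → Δ ⊢m u ∶ B → A ≈M B →
          (Γ +E Δ) ⊢ app t u ∶ τ

  data _⊢m_∶_ : Env → Term → MTy → Set where
    []  : ∀ {t} → ∅ ⊢m t ∶ []
    _∷_ : ∀ {Δ Δs t σ A} → Δ ⊢ t ∶ σ → Δs ⊢m t ∶ A →
          (Δ +E Δs) ⊢m t ∶ (σ ∷ A)

mutual
  𝒜 : ∀ {Γ t σ} → Γ ⊢ t ∶ σ → Term
  𝒜 (var x ρ) = var x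
  𝒜 (lam Π) = lam (𝒜 Π)
  𝒜 (app Π Π′ _) = app (𝒜 Π) (𝒜m Π′)

  𝒜m : ∀ {Γ t A} → Γ ⊢m t ∶ A → Term
  𝒜m [] = Ω
  𝒜m (Π ∷ Πs) = 𝒜 Π ⊔ 𝒜m Πs

Finite : (Term → Set) → Set
Finite P = ∃[ L ] (∀ a → P a → a ∈ L)

Approx : Env → Ty → Term → Set
Approx Γ σ a = IsANF a × (∃[ Γ′ ] ∃[ σ′ ] Σ[ Π ∈ (Γ′ ⊢ a ∶ σ′) ]
                 (Γ′ ≈E Γ × σ′ ≈T σ × 𝒜 Π ≡ a))

-- Measure a type by its number of constructors, counting also one for each element of a
-- multiset.  Typing in H is linear: each node of the approximant of a derivation consumes a
-- distinct part of the environment or of the type.  Hence a normal approximant has size at most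
-- |Γ| + |σ|, and a neutral one even satisfies |a| + |σ| ≤ |Γ|, since the type of its head
-- variable, drawn from Γ, supplies an arrow for each argument as well as the target σ.  Every
-- free variable of an approximant is given a nonempty multiset by Γ, so the approximants lie
-- among the finitely many terms of size at most |Γ| + |σ| over the first length Γ variables.
module Submission where

open import Defs
open import Data.Nat using (ℕ; zero; suc; _+_; _≤_; _<_; z≤n; s≤s)
open import Data.Nat.Properties
  using (≤-refl; ≤-reflexive; ≤-trans; m≤m+n; m≤n+m; n≤1+n; +-assoc; +-identityʳ; +-suc;
         +-commutativeSemigroup;
         +-mono-≤; +-monoʳ-≤; +-cancelʳ-≤; module ≤-Reasoning)
open import Data.Nat.Tactic.RingSolver using (solve-∀)
open import Algebra.Properties.CommutativeSemigroup +-commutativeSemigroup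
  using (interchange; x∙yz≈y∙xz; xy∙z≈y∙xz)
open import Data.List using (List; []; _∷_; _++_; map; length; upTo; cartesianProductWith)
open import Data.List.Properties using (++-conicalˡ; ++-conicalʳ; ++-identityʳ)
open import Data.List.Membership.Propositional using (_∈_)
open import Data.List.Membership.Propositional.Properties
  using (∈-map⁺; ∈-++⁺ˡ; ∈-++⁺ʳ; ∈-upTo⁺; ∈-cartesianProductWith⁺)
open import Data.List.Relation.Unary.Any using (here; there)
open import Data.Product using (_,_)
open import Data.Sum using (_⊎_; inj₁; inj₂) renaming (map to ⊎-map)
open import Data.Empty using (⊥; ⊥-elim)
open import Function using (_∘_)
open import Relation.Binary.PropositionalEquality
  using (_≡_; _≢_; refl; sym; trans; cong; cong₂; subst; module ≡-Reasoning)

mutual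
  tySize : Ty → ℕ
  tySize (base _) = 1
  tySize (A ⇒ τ) = suc (mtySize A + tySize τ)

  mtySize : MTy → ℕ
  mtySize [] = 0
  mtySize (σ ∷ A) = suc (tySize σ + mtySize A)

envSize : Env → ℕ
envSize [] = 0
envSize (A ∷ Γ) = mtySize A + envSize Γ

termSize : Term → ℕ
termSize Ω = 0
termSize (var _) = 1
termSize (lam t) = suc (termSize t)
termSize (app t u) = suc (termSize t + termSize u)

mtySize-++ : ∀ A B → mtySize (A ++ B) ≡ mtySize A + mtySize B
mtySize-++ [] B = refl
mtySize-++ (σ ∷ A) B =
  cong suc (trans (cong (tySize σ +_) (mtySize-++ A B)) (sym (+-assoc (tySize σ) (mtySize A) (mtySize B))))

mutual
  tySize-≈T : ∀ {σ τ} → σ ≈T τ → tySize σ ≡ tySize τ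
  tySize-≈T base = refl
  tySize-≈T (arr A≈B σ≈τ) = cong₂ (λ m n → suc (m + n)) (mtySize-≈M A≈B) (tySize-≈T σ≈τ)

  mtySize-≈M : ∀ {A B} → A ≈M B → mtySize A ≡ mtySize B
  mtySize-≈M [] = refl
  mtySize-≈M (_∷_ {σ} {τ} {A} {B₁} {B₂} σ≈τ A≈B) = begin
    suc (tySize σ + mtySize A)                  ≡⟨ cong₂ (λ m n → suc (m + n)) (tySize-≈T σ≈τ) (mtySize-≈M A≈B) ⟩
    suc (tySize τ + mtySize (B₁ ++ B₂))         ≡⟨ cong (λ n → suc (tySize τ + n)) (mtySize-++ B₁ B₂) ⟩
    suc (tySize τ + (mtySize B₁ + mtySize B₂))  ≡⟨ cong suc (x∙yz≈y∙xz (tySize τ) (mtySize B₁) (mtySize B₂)) ⟩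
    suc (mtySize B₁ + (tySize τ + mtySize B₂))  ≡⟨ +-suc (mtySize B₁) _ ⟨
    mtySize B₁ + suc (tySize τ + mtySize B₂)    ≡⟨ mtySize-++ B₁ (τ ∷ B₂) ⟨
    mtySize (B₁ ++ τ ∷ B₂)                      ∎
    where open ≡-Reasoning

-- Environments of different lengths can be equivalent: the surplus entries are empty.
envSize-≈E : ∀ Γ Δ → Γ ≈E Δ → envSize Γ ≡ envSize Δ
envSize-≈E [] [] _ = refl
envSize-≈E [] (B ∷ Δ) e = cong₂ _+_ (mtySize-≈M (e 0)) (envSize-≈E [] Δ (e ∘ suc))
envSize-≈E (A ∷ Γ) [] e = cong₂ _+_ (mtySize-≈M (e 0)) (envSize-≈E Γ [] (e ∘ suc))
envSize-≈E (A ∷ Γ) (B ∷ Δ) e = cong₂ _+_ (mtySize-≈M (e 0)) (envSize-≈E Γ Δ (e ∘ suc))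

envSize-+E : ∀ Γ Δ → envSize (Γ +E Δ) ≡ envSize Γ + envSize Δ
envSize-+E [] Δ = refl
envSize-+E (A ∷ Γ) [] = sym (+-identityʳ _)
envSize-+E (A ∷ Γ) (B ∷ Δ) = begin
  mtySize (A ++ B) + envSize (Γ +E Δ)
    ≡⟨ cong₂ _+_ (mtySize-++ A B) (envSize-+E Γ Δ) ⟩
  mtySize A + mtySize B + (envSize Γ + envSize Δ)
    ≡⟨ interchange (mtySize A) (mtySize B) (envSize Γ) (envSize Δ) ⟩
  mtySize A + envSize Γ + (mtySize B + envSize Δ) ∎
  where open ≡-Reasoning

envSize-single : ∀ x A → envSize (single x A) ≡ mtySize A
envSize-single zero A = +-identityʳ _
envSize-single (suc x) A = envSize-single x A

envSize-hd-tl : ∀ Γ → envSize Γ ≡ mtySize (hd Γ) + envSize (tl Γ)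
envSize-hd-tl [] = refl
envSize-hd-tl (A ∷ Γ) = refl

data Join : Term → Term → Term → Set where
  left  : ∀ {a b} → Join a b a
  right : ∀ {b} → Join Ω b b
  lam   : ∀ {a b} → Join (lam a) (lam b) (lam (a ⊔ b))
  app   : ∀ {a b c d} → Join (app a b) (app c d) (app (a ⊔ c) (b ⊔ d))

join-view : ∀ a b → Join a b (a ⊔ b)
join-view Ω b = right
join-view (var x) Ω = left
join-view (lam a) Ω = left
join-view (app a b) Ω = left
join-view (var x) (var y) = left
join-view (var x) (lam b) = left
join-view (var x) (app b d) = left
join-view (lam a) (var y) = left
join-view (lam a) (lam b) = lam
join-view (lam a) (app b d) = left
join-view (app a b) (var y) = left
join-view (app a b) (lam c) = left
join-view (app a b) (app c d) = app

termSize-⊔ : ∀ a b → termSize (a ⊔ b) ≤ termSize a + termSize b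
termSize-⊔ a b with a ⊔ b | join-view a b
... | _ | left = m≤m+n _ _
... | _ | right = ≤-refl
... | _ | lam {a} {b} = s≤s (≤-trans (termSize-⊔ a b) (+-monoʳ-≤ (termSize a) (n≤1+n _)))
... | _ | app {a} {b} {c} {d} = s≤s (begin
  termSize (a ⊔ c) + termSize (b ⊔ d)                 ≤⟨ +-mono-≤ (termSize-⊔ a c) (termSize-⊔ b d) ⟩
  termSize a + termSize c + (termSize b + termSize d) ≡⟨ interchange (termSize a) (termSize c) (termSize b) (termSize d) ⟩
  termSize a + termSize b + (termSize c + termSize d) ≤⟨ +-monoʳ-≤ (termSize a + termSize b) (n≤1+n _) ⟩
  termSize a + termSize b + suc (termSize c + termSize d) ∎)
  where open ≤-Reasoning

mutual
  nf-approx-size : ∀ {Γ t σ} → IsNF t → (Π : Γ ⊢ t ∶ σ) →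
                   termSize (𝒜 Π) ≤ envSize Γ + tySize σ
  nf-approx-size (lam t-nf) (lam {Γ} {τ = τ} Π) = begin
    suc (termSize (𝒜 Π))                               ≤⟨ s≤s (nf-approx-size t-nf Π) ⟩
    suc (envSize Γ + tySize τ)                         ≡⟨ cong (λ n → suc (n + tySize τ)) (envSize-hd-tl Γ) ⟩
    suc (mtySize (hd Γ) + envSize (tl Γ) + tySize τ)   ≡⟨ cong suc (xy∙z≈y∙xz (mtySize (hd Γ)) (envSize (tl Γ)) (tySize τ)) ⟩
    suc (envSize (tl Γ) + (mtySize (hd Γ) + tySize τ)) ≡⟨ +-suc (envSize (tl Γ)) _ ⟨
    envSize (tl Γ) + suc (mtySize (hd Γ) + tySize τ)   ∎
    where open ≤-Reasoning
  nf-approx-size {σ = σ} (ne t-ne) Π =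
    ≤-trans (m≤m+n _ (tySize σ)) (≤-trans (ne-approx-size t-ne Π) (m≤m+n _ _))

  ne-approx-size : ∀ {Γ t σ} → IsNe t → (Π : Γ ⊢ t ∶ σ) →
                   termSize (𝒜 Π) + tySize σ ≤ envSize Γ
  ne-approx-size var (var x ρ) =
    ≤-reflexive (trans (cong suc (sym (+-identityʳ _))) (sym (envSize-single x (ρ ∷ []))))
  ne-approx-size (app t-ne u-anf) (app {Γ} {Δ} {A = A} {B} {τ} Π Πs A≈B) =
    +-cancelʳ-≤ (mtySize B) _ _ (begin
      suc (st + su) + tySize τ + mtySize B      ≡⟨ shuffle st su (tySize τ) (mtySize B) ⟩
      st + suc (mtySize B + tySize τ) + su      ≡⟨ cong (λ m → st + suc (m + tySize τ) + su) (sym (mtySize-≈M A≈B)) ⟩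
      st + suc (mtySize A + tySize τ) + su      ≤⟨ +-mono-≤ (ne-approx-size t-ne Π) (anf-approxm-size u-anf Πs) ⟩
      envSize Γ + (envSize Δ + mtySize B)       ≡⟨ sym (+-assoc (envSize Γ) (envSize Δ) (mtySize B)) ⟩
      envSize Γ + envSize Δ + mtySize B         ≡⟨ cong (_+ mtySize B) (sym (envSize-+E Γ Δ)) ⟩
      envSize (Γ +E Δ) + mtySize B              ∎)
    where
    open ≤-Reasoning
    st = termSize (𝒜 Π)
    su = termSize (𝒜m Πs)
    shuffle : ∀ a b t m → suc (a + b) + t + m ≡ a + suc (m + t) + b
    shuffle = solve-∀

  anf-approxm-size : ∀ {Δ t A} → IsANF t → (Πs : Δ ⊢m t ∶ A) →
                     termSize (𝒜m Πs) ≤ envSize Δ + mtySize A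
  anf-approxm-size _ [] = z≤n
  anf-approxm-size Ω (() ∷ _)
  anf-approxm-size (nf t-nf) (_∷_ {Δ} {Δs} {σ = σ} {A} Π Πs) = begin
    termSize (𝒜 Π ⊔ 𝒜m Πs)                            ≤⟨ termSize-⊔ (𝒜 Π) (𝒜m Πs) ⟩
    termSize (𝒜 Π) + termSize (𝒜m Πs)                 ≤⟨ +-mono-≤ (nf-approx-size t-nf Π) (anf-approxm-size (nf t-nf) Πs) ⟩
    envSize Δ + tySize σ + (envSize Δs + mtySize A)
      ≡⟨ interchange (envSize Δ) (tySize σ) (envSize Δs) (mtySize A) ⟩
    envSize Δ + envSize Δs + (tySize σ + mtySize A)   ≤⟨ +-monoʳ-≤ (envSize Δ + envSize Δs) (n≤1+n _) ⟩
    envSize Δ + envSize Δs + suc (tySize σ + mtySize A) ≡⟨ cong (_+ suc (tySize σ + mtySize A)) (envSize-+E Δ Δs) ⟨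
    envSize (Δ +E Δs) + suc (tySize σ + mtySize A)    ∎
    where open ≤-Reasoning

Occurs : ℕ → Term → Set
Occurs x Ω = ⊥
Occurs x (var y) = x ≡ y
Occurs x (lam t) = Occurs (suc x) t
Occurs x (app t u) = Occurs x t ⊎ Occurs x u

Scoped : ℕ → Term → Set
Scoped n t = ∀ x → Occurs x t → x < n

occurs-⊔ : ∀ {x} a b → Occurs x (a ⊔ b) → Occurs x a ⊎ Occurs x b
occurs-⊔ a b o with a ⊔ b | join-view a b
... | _ | left = inj₁ o
... | _ | right = inj₂ o
... | _ | lam {a} {b} = occurs-⊔ a b o
... | _ | app {a} {b} {c} {d} with o
...   | inj₁ o₁ = ⊎-map inj₁ inj₁ (occurs-⊔ a c o₁)
...   | inj₂ o₂ = ⊎-map inj₂ inj₂ (occurs-⊔ b d o₂)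

!-+E : ∀ Γ Δ x → (Γ +E Δ) ! x ≡ (Γ ! x) ++ (Δ ! x)
!-+E [] Δ x = refl
!-+E (A ∷ Γ) [] zero = sym (++-identityʳ A)
!-+E (A ∷ Γ) [] (suc x) = sym (++-identityʳ _)
!-+E (A ∷ Γ) (B ∷ Δ) zero = refl
!-+E (A ∷ Γ) (B ∷ Δ) (suc x) = !-+E Γ Δ x

!-tl : ∀ Γ x → Γ ! suc x ≡ tl Γ ! x
!-tl [] x = refl
!-tl (A ∷ Γ) x = refl

!-single : ∀ x A → single x A ! x ≡ A
!-single zero A = refl
!-single (suc x) A = !-single x A

+E-nonempty : ∀ Γ Δ x → Γ ! x ≢ [] ⊎ Δ ! x ≢ [] → (Γ +E Δ) ! x ≢ []
+E-nonempty Γ Δ x (inj₁ Γx≢[]) e = Γx≢[] (++-conicalˡ (Γ ! x) (Δ ! x) (trans (sym (!-+E Γ Δ x)) e))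
+E-nonempty Γ Δ x (inj₂ Δx≢[]) e = Δx≢[] (++-conicalʳ (Γ ! x) (Δ ! x) (trans (sym (!-+E Γ Δ x)) e))

≈M-[] : ∀ {A B} → A ≈M B → B ≡ [] → A ≡ []
≈M-[] [] _ = refl
≈M-[] (_∷_ {B₁ = []} _ _) ()
≈M-[] (_∷_ {B₁ = _ ∷ _} _ _) ()

mutual
  occurs⇒nonempty : ∀ {Γ t σ x} (Π : Γ ⊢ t ∶ σ) → Occurs x (𝒜 Π) → Γ ! x ≢ []
  occurs⇒nonempty (var x ρ) refl rewrite !-single x (ρ ∷ []) = λ ()
  occurs⇒nonempty {x = x} (lam {Γ} Π) o = subst (_≢ []) (!-tl Γ x) (occurs⇒nonempty Π o)
  occurs⇒nonempty {x = x} (app {Γ} {Δ} Π Πs _) o =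
    +E-nonempty Γ Δ x (⊎-map (occurs⇒nonempty Π) (occursm⇒nonempty Πs) o)

  occursm⇒nonempty : ∀ {Γ t A x} (Πs : Γ ⊢m t ∶ A) → Occurs x (𝒜m Πs) → Γ ! x ≢ []
  occursm⇒nonempty {x = x} (_∷_ {Δ} {Δs} Π Πs) o =
    +E-nonempty Δ Δs x (⊎-map (occurs⇒nonempty Π) (occursm⇒nonempty Πs) (occurs-⊔ (𝒜 Π) (𝒜m Πs) o))

nonempty⇒<length : ∀ Γ x → Γ ! x ≢ [] → x < length Γ
nonempty⇒<length [] x nonempty = ⊥-elim (nonempty refl)
nonempty⇒<length (A ∷ Γ) zero _ = s≤s z≤n
nonempty⇒<length (A ∷ Γ) (suc x) nonempty = s≤s (nonempty⇒<length Γ x nonempty)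

approx-scoped : ∀ Γ {Γ′ t σ} (Π : Γ′ ⊢ t ∶ σ) → Γ′ ≈E Γ → Scoped (length Γ) (𝒜 Π)
approx-scoped Γ Π Γ′≈Γ x o =
  nonempty⇒<length Γ x (λ Γx≡[] → occurs⇒nonempty Π o (≈M-[] (Γ′≈Γ x) Γx≡[]))

boundedTerms : ℕ → ℕ → List Term
boundedTerms zero n = Ω ∷ []
boundedTerms (suc s) n =
  Ω ∷ map var (upTo n) ++ map lam (boundedTerms s (suc n)) ++
  cartesianProductWith app (boundedTerms s n) (boundedTerms s n)

∈-boundedTerms : ∀ {n} t s → termSize t ≤ s → Scoped n t → t ∈ boundedTerms s n
∈-boundedTerms Ω zero _ _ = here refl
∈-boundedTerms Ω (suc s) _ _ = here refl
∈-boundedTerms (var x) (suc s) _ scoped = there (∈-++⁺ˡ (∈-map⁺ var (∈-upTo⁺ (scoped x refl))))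
∈-boundedTerms {n} (lam t) (suc s) (s≤s size≤) scoped =
  there (∈-++⁺ʳ (map var (upTo n)) (∈-++⁺ˡ (∈-map⁺ lam (∈-boundedTerms t s size≤ body-scoped))))
  where
  body-scoped : Scoped (suc n) t
  body-scoped zero _ = s≤s z≤n
  body-scoped (suc x) o = s≤s (scoped x o)
∈-boundedTerms {n} (app t u) (suc s) (s≤s size≤) scoped =
  there (∈-++⁺ʳ (map var (upTo n)) (∈-++⁺ʳ (map lam (boundedTerms s (suc n)))
    (∈-cartesianProductWith⁺ app
      (∈-boundedTerms t s (≤-trans (m≤m+n _ _) size≤) (λ x → scoped x ∘ inj₁))
      (∈-boundedTerms u s (≤-trans (m≤n+m _ _) size≤) (λ x → scoped x ∘ inj₂)))))

corollary3p13 : (Γ : Env) (σ : Ty) → Finite (Approx Γ σ)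
corollary3p13 Γ σ = boundedTerms (envSize Γ + tySize σ) (length Γ) , approx∈
  where
  approx∈ : ∀ a → Approx Γ σ a → a ∈ boundedTerms (envSize Γ + tySize σ) (length Γ)
  approx∈ .Ω (Ω , _ , _ , () , _)
  approx∈ _ (nf a-nf , Γ′ , σ′ , Π , Γ′≈Γ , σ′≈σ , 𝒜Π≡a) =
    subst (_∈ _) 𝒜Π≡a (∈-boundedTerms (𝒜 Π) _ size≤ (approx-scoped Γ Π Γ′≈Γ))
    where
    size≤ : termSize (𝒜 Π) ≤ envSize Γ + tySize σ
    size≤ = ≤-trans (nf-approx-size a-nf Π)
                    (≤-reflexive (cong₂ _+_ (envSize-≈E Γ′ Γ Γ′≈Γ) (tySize-≈T σ′≈σ)))
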